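{- For every integer $n > 1$, $\mathsf{mtw}(K_{n,n}) = 2n-2$.
   Context: $K_{n,n}$ is the complete bipartite graph with both parts of size $n$. A tree decomposition of $G$ is a tree $T$ with bags $B(t)\subseteq V(G)$ such that every edge lies in some bag and, for each vertex, the bags containing it form a nonempty connected subtree; width is maximum bag size minus one. A bag is matched if the subgraph of $G$ induced by the bag has a perfect matching, or has a matching leaving exactly one vertex $v$ of the bag unmatched with $v$ adjacent to some matched vertex. $\mathsf{mtw}(G)$ is the minimum width of a tree decomposition all of whose bags are matched. -}

module Defs where

open import Data.Nat using (ℕ; zero; suc; _≤_; _∸_; _⊔_)
open import Data.Fin using (Fin; zero; suc; splitAt)
open import Data.Fin.Subset using (Subset; _∈_; ∣_∣)
open import Data.Bool using (Bool; true; false)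
open import Data.Sum using (_⊎_; inj₁; inj₂)
open import Data.Product using (Σ; ∃; _×_; _,_)
open import Data.List using (List; []; _∷_; length; concatMap; _∷ʳ_)
open import Data.List.Membership.Propositional renaming (_∈_ to _∈ₗ_)
open import Data.List.Relation.Unary.All using (All)
open import Data.List.Relation.Unary.Linked using (Linked)
open import Data.List.Relation.Unary.Unique.Propositional using (Unique)
open import Relation.Nullary using (¬_)
open import Relation.Binary.PropositionalEquality using (_≡_; _≢_; refl; sym)
open import Function using (_∘_)
open import Data.Unit using (⊤)

record Graph (m : ℕ) : Set₁ where
  field
    Adj     : Fin m → Fin m → Set
    symm    : ∀ {u v} → Adj u v → Adj v u
    irrefl  : ∀ {u} → ¬ Adj u u
open Graph public

data WalkIn {m} (G : Graph m) (P : Fin m → Set) : Fin m → Fin m → Set where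
  stop : ∀ {u} → P u → WalkIn G P u u
  step : ∀ {u w v} → P u → Adj G u w → WalkIn G P w v → WalkIn G P u v

Connected : ∀ {m} → Graph m → Set
Connected {m} G = ∀ (u v : Fin m) → WalkIn G (λ _ → ⊤) u v

IsCycle : ∀ {m} → Graph m → Fin m → List (Fin m) → Set
IsCycle G x xs = (2 ≤ length xs) × Unique (x ∷ xs) × Linked (Adj G) ((x ∷ xs) ∷ʳ x)

Acyclic : ∀ {m} → Graph m → Set
Acyclic G = ∀ x xs → ¬ IsCycle G x xs

IsTree : ∀ {k} → Graph (suc k) → Set
IsTree T = Connected T × Acyclic T

maxOver : ∀ {k} → (Fin k → ℕ) → ℕ
maxOver {zero}  f = 0
maxOver {suc k} f = f zero ⊔ maxOver (f ∘ suc)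

record TreeDecomposition {m} (G : Graph m) : Set₁ where
  field
    nodes    : ℕ                              -- tree has suc nodes vertices
    tree     : Graph (suc nodes)
    isTree   : IsTree tree
    bag      : Fin (suc nodes) → Subset m
    edgeCov  : ∀ u v → Adj G u v → ∃ λ t → (u ∈ bag t) × (v ∈ bag t)
    vertNonempty : ∀ v → ∃ λ t → v ∈ bag t
    vertConn : ∀ v t t' → v ∈ bag t → v ∈ bag t' → WalkIn tree (λ s → v ∈ bag s) t t'
open TreeDecomposition public

width : ∀ {m} {G : Graph m} → TreeDecomposition G → ℕ
width D = maxOver (λ t → ∣ bag D t ∣) ∸ 1

endpoints : ∀ {m} → List (Fin m × Fin m) → List (Fin m)
endpoints = concatMap (λ { (u , w) → u ∷ w ∷ [] })

IsMatchingIn : ∀ {m} → Graph m → Subset m → List (Fin m × Fin m) → Set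
IsMatchingIn G S M =
  All (λ { (u , w) → Adj G u w × u ∈ S × w ∈ S }) M × Unique (endpoints M)

Matched : ∀ {m} → Graph m → Subset m → Set
Matched {m} G S =
  (Σ (List (Fin m × Fin m)) λ M → IsMatchingIn G S M
      × (∀ v → v ∈ S → v ∈ₗ endpoints M))
  ⊎
  (Σ (List (Fin m × Fin m)) λ M → IsMatchingIn G S M
      × Σ (Fin m) λ v → v ∈ S × ¬ (v ∈ₗ endpoints M)
        × (∀ w → w ∈ S → w ≢ v → w ∈ₗ endpoints M)
        × (Σ (Fin m) λ u → u ∈ₗ endpoints M × Adj G v u))

AllBagsMatched : ∀ {m} {G : Graph m} → TreeDecomposition G → Set
AllBagsMatched {G = G} D = ∀ t → Matched G (bag D t)

MtwIs : ∀ {m} → Graph m → ℕ → Set₁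
MtwIs G w =
  (Σ (TreeDecomposition G) λ D → AllBagsMatched D × width D ≡ w)
  × (∀ (D : TreeDecomposition G) → AllBagsMatched D → w ≤ width D)

-- K_{n,n} on Fin (n + n): the first n vertices form one side, the last n the other.
side : ∀ n → Fin (n Data.Nat.+ n) → Bool
side n i with splitAt n i
... | inj₁ _ = true
... | inj₂ _ = false

K : (n : ℕ) → Graph (n Data.Nat.+ n)
K n = record
  { Adj    = λ i j → side n i ≢ side n j
  ; symm   = λ p q → p (sym q)
  ; irrefl = λ p → p refl
  }

-- In every tree decomposition of K_{n,n} some bag contains a whole side: otherwise
-- repeatedly delete a pendant node ℓ of a subtree whose bags still cover all edges. A vertex of
-- bag ℓ missing from the neighbouring bag would occur in no other bag of the subtree, so its whole
-- neighbourhood, the other side, would lie in bag ℓ; hence ℓ can go. A matched bag containing a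
-- whole side has every vertex of that side but at most one matched into the other side, so it has
-- at least 2n - 1 vertices. For two vertices a₀, a₁ of the same side, the bags V ∖ {a₀} and V ∖ {a₁} on a
-- single tree edge form a decomposition of width 2n - 2; each bag is matched by pairing aᵢ with
-- bᵢ, which leaves one vertex exposed next to a matched one.

module Submission where

open import Defs
open import Data.Nat using (ℕ; zero; suc; _≤_; _<_; _+_; _*_; _∸_; _⊔_; z≤n; s≤s)
open import Data.Nat.Properties
open import Data.Nat.Solver using (module +-*-Solver)
open import Data.Fin using (Fin; zero; suc; _↑ˡ_; _↑ʳ_; splitAt)
open import Data.Fin.Properties using (injective⇒≤; any?; all?; ↑ˡ-injective; ↑ʳ-injective; splitAt-↑ˡ; splitAt-↑ʳ; splitAt⁻¹-↑ˡ; splitAt⁻¹-↑ʳ) renaming (_≟_ to _≟ᶠ_)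
open import Data.Fin.Subset using (Subset; inside; outside; ∣_∣; _─_; _-_; ⁅_⁆; ⊤; ∁) renaming (_∈_ to _∈ˢ_; _∉_ to _∉ˢ_)
open import Data.Fin.Subset.Properties using (x∈p∧x≢y⇒x∈p-y; x∈p⇒∣p-x∣<∣p∣; x∉⁅y⁆⇒x≢y; x≢y⇒x∉⁅y⁆; x∈⁅x⁆; x∉p⇒x∈∁p; x∈∁p⇒x∉p; ∣∁p∣≡n∸∣p∣; ∣⁅x⁆∣≡1; p─q⊆p; _∈?_; ∈⊤; ∣p∣≤n)
import Data.Vec as Vec
open import Data.Bool using (Bool; true; false)
import Data.Bool.Properties as Bool
open import Data.List using (List; []; _∷_; length; lookup; map; filter; allFin; _++_; _∷ʳ_)
open import Data.List.Properties using (length-++; length-map)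
open import Data.List.Membership.Propositional using () renaming (_∈_ to _∈ₗ_)
open import Data.List.Membership.Propositional.Properties using (∈-∃++; ∈-++⁻; ∈-++⁺ˡ; ∈-++⁺ʳ; ∈-filter⁺; ∈-filter⁻; ∈-allFin)
open import Data.List.Membership.DecPropositional using () renaming (_∈?_ to ∈ₗ?)
open import Data.List.Relation.Unary.Any using (here; there; index)
open import Data.List.Relation.Unary.Any.Properties using (lookup-index)
open import Data.List.Relation.Unary.All as All using (All; []; _∷_)
import Data.List.Relation.Unary.All.Properties as All
open import Data.List.Relation.Unary.All.Properties using (¬Any⇒All¬)
open import Data.List.Relation.Unary.AllPairs using (AllPairs; []; _∷_)
open import Data.List.Relation.Unary.Linked using (Linked; []; [-]; _∷_)
open import Data.List.Relation.Unary.Unique.Propositional using (Unique)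
open import Data.List.Relation.Unary.Unique.Propositional.Properties using (filter⁺; allFin⁺)
open import Data.Product using (Σ; ∃; ∃₂; _×_; _,_; proj₁; proj₂)
open import Data.Sum using (_⊎_; inj₁; inj₂)
open import Data.Empty using (⊥; ⊥-elim)
open import Function using (_∘_; id)
open import Relation.Nullary using (¬_; yes; no; ¬?)
open import Relation.Nullary.Decidable using (_⊎-dec_; decidable-stable)
open import Relation.Binary.PropositionalEquality

private variable
  m N : ℕ

x∈p─q⇒x∉q : ∀ {x : Fin m} {p q} → x ∈ˢ p ─ q → x ∉ˢ q
x∈p─q⇒x∉q {p = inside Vec.∷ _} {outside Vec.∷ _} Vec.here ()
x∈p─q⇒x∉q {p = _ Vec.∷ _} {_ Vec.∷ _} (Vec.there x∈p─q) (Vec.there x∈q) = x∈p─q⇒x∉q x∈p─q x∈q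

x∈p-y⇒x≢y : ∀ {x y : Fin m} {p} → x ∈ˢ p - y → x ≢ y
x∈p-y⇒x≢y = x∉⁅y⁆⇒x≢y ∘ x∈p─q⇒x∉q

unique⇒length≤∣∣ : ∀ {S : Subset m} {xs} → Unique xs → All (_∈ˢ S) xs → length xs ≤ ∣ S ∣
unique⇒length≤∣∣ [] [] = z≤n
unique⇒length≤∣∣ (x∉xs ∷ xs!) (x∈S ∷ xs⊆S) =
  ≤-trans (s≤s (unique⇒length≤∣∣ xs! (All.zipWith (λ (y∈S , x≢y) → x∈p∧x≢y⇒x∈p-y y∈S (x≢y ∘ sym)) (xs⊆S , x∉xs))))
          (x∈p⇒∣p-x∣<∣p∣ x∈S)

injective⇒≤length : ∀ {k} {A : Set} {ys : List A} (f : Fin k → A) →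
                    (∀ {i j} → f i ≡ f j → i ≡ j) → (∀ i → f i ∈ₗ ys) → k ≤ length ys
injective⇒≤length {ys = ys} f f-inj f∈ys = injective⇒≤ λ {i} {j} eq → f-inj (begin
  f i                           ≡⟨ lookup-index (f∈ys i) ⟩
  lookup ys (index (f∈ys i))    ≡⟨ cong (lookup ys) eq ⟩
  lookup ys (index (f∈ys j))    ≡⟨ lookup-index (f∈ys j) ⟨
  f j                           ∎)
  where open ≡-Reasoning

-- Walks and pendant nodes

module _ {T : Graph N} where

  walk-head : ∀ {Q : Fin N → Set} {u v} → WalkIn T Q u v → Q u
  walk-head (stop q)     = q
  walk-head (step q _ _) = q

  walk-map : ∀ {Q Q′ : Fin N → Set} → (∀ {s} → Q s → Q′ s) → ∀ {u v} → WalkIn T Q u v → WalkIn T Q′ u v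
  walk-map f (stop q)        = stop (f q)
  walk-map f (step q uw wv) = step (f q) uw (walk-map f wv)

  module _ {Q : Fin N → Set} {ℓ p : Fin N} (only-p : ∀ {x} → Q x → Adj T ℓ x → x ≡ p) where

    walk-from-pendant : ¬ Q p → ∀ {t} → WalkIn T Q ℓ t → t ≡ ℓ
    walk-from-pendant ¬Qp (stop _)        = refl
    walk-from-pendant ¬Qp (step _ ℓw wt) =
      ⊥-elim (¬Qp (subst Q (only-p (walk-head wt) ℓw) (walk-head wt)))

    -- A walk entering ℓ must come from p and return to p, so the detour can be cut out.
    walk-avoiding-pendant : p ≢ ℓ → ∀ {u v} → u ≢ ℓ → v ≢ ℓ → WalkIn T Q u v → WalkIn T (λ s → Q s × s ≢ ℓ) u v
    walk-avoiding-pendant p≢ℓ u≢ℓ v≢ℓ (stop q) = stop (q , u≢ℓ)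
    walk-avoiding-pendant p≢ℓ u≢ℓ v≢ℓ (step {w = w} qu uw wv) with w ≟ᶠ ℓ
    ... | no w≢ℓ = step (qu , u≢ℓ) uw (walk-avoiding-pendant p≢ℓ w≢ℓ v≢ℓ wv)
    ... | yes refl with wv
    ...   | stop _ = ⊥-elim (v≢ℓ refl)
    ...   | step qx ℓx xv =
            subst (λ z → WalkIn T _ z _) (trans x≡p (sym u≡p))
                  (walk-avoiding-pendant p≢ℓ (λ x≡ℓ → p≢ℓ (trans (sym x≡p) x≡ℓ)) v≢ℓ xv)
      where
        x≡p = only-p (walk-head xv) ℓx
        u≡p = only-p qu (symm T uw)

module _ {A : Set} where

  All-prefix : ∀ {P : A → Set} ys {x zs} → All P (ys ++ x ∷ zs) → All P (ys ∷ʳ x)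
  All-prefix []       (px ∷ _)   = px ∷ []
  All-prefix (_ ∷ ys) (py ∷ pys) = py ∷ All-prefix ys pys

  AllPairs-prefix : ∀ {R : A → A → Set} ys {x zs} → AllPairs R (ys ++ x ∷ zs) → AllPairs R (ys ∷ʳ x)
  AllPairs-prefix []       (_ ∷ _)      = [] ∷ []
  AllPairs-prefix (_ ∷ ys) (Ry ∷ Rys) = All-prefix ys Ry ∷ AllPairs-prefix ys Rys

  Linked-prefix-∷ʳ : ∀ {R : A → A → Set} a ys {x zs h} → Linked R (a ∷ ys ++ x ∷ zs) → R x h →
                     Linked R ((a ∷ ys ∷ʳ x) ∷ʳ h)
  Linked-prefix-∷ʳ a []       (Rax ∷ _)  Rxh = Rax ∷ Rxh ∷ [-]
  Linked-prefix-∷ʳ a (y ∷ ys) (Ray ∷ Rys) Rxh = Ray ∷ Linked-prefix-∷ʳ y ys Rys Rxh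

module _ (T : Graph N) where

  adj⇒≢ : ∀ {u v} → Adj T u v → v ≢ u
  adj⇒≢ uv refl = irrefl T uv

  record Pendant (R : Subset N) (ℓ p : Fin N) : Set where
    field
      ℓ∈R            : ℓ ∈ˢ R
      p∈R            : p ∈ˢ R
      ℓ-p            : Adj T ℓ p
      only-neighbour : ∀ {x} → x ∈ˢ R → Adj T ℓ x → x ≡ p

  ConnectedIn : Subset N → Set
  ConnectedIn R = ∀ {t t′} → t ∈ˢ R → t′ ∈ˢ R → WalkIn T (_∈ˢ R) t t′

  IsPathIn : Subset N → List (Fin N) → Set
  IsPathIn R ps = Unique ps × Linked (Adj T) ps × All (_∈ˢ R) ps

module _ {T : Graph N} (acyclic : Acyclic T) {R : Subset N} where

  -- A neighbour of the end h other than q lies either outside the path (so the path extends) or on it (closing a cycle).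
  unextendable⇒pendant : ∀ {h q rest} → IsPathIn T R (h ∷ q ∷ rest) →
                         (∀ x → ¬ IsPathIn T R (x ∷ h ∷ q ∷ rest)) → Pendant T R h q
  unextendable⇒pendant {h} {q} {rest} path@(unique , linked@(hq ∷ _) , h∈R ∷ q∈R ∷ _) maximal =
    record { ℓ∈R = h∈R ; p∈R = q∈R ; ℓ-p = hq ; only-neighbour = only-q }
    where
      only-q : ∀ {x} → x ∈ˢ R → Adj T h x → x ≡ q
      only-q {x} x∈R hx with x ≟ᶠ q
      ... | yes x≡q = x≡q
      ... | no x≢q with ∈ₗ? _≟ᶠ_ x rest
      ...   | no x∉rest = ⊥-elim (maximal x
                ( (adj⇒≢ T hx ∷ x≢q ∷ ¬Any⇒All¬ rest x∉rest) ∷ unique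
                , symm T hx ∷ linked
                , x∈R ∷ proj₂ (proj₂ path)))
      ...   | yes x∈rest with ∈-∃++ x∈rest
      ...     | ys , zs , refl = ⊥-elim (acyclic h (q ∷ ys ∷ʳ x)
                  ( s≤s (1≤length-∷ʳ ys)
                  , AllPairs-prefix (h ∷ q ∷ ys) unique
                  , Linked-prefix-∷ʳ h (q ∷ ys) linked (symm T hx)))
        where
          1≤length-∷ʳ : ∀ (ys : List (Fin N)) → 1 ≤ length (ys ∷ʳ x)
          1≤length-∷ʳ []      = s≤s z≤n
          1≤length-∷ʳ (_ ∷ _) = s≤s z≤n

  module _ (no-pendant : ∀ {ℓ p} → ¬ Pendant T R ℓ p) where

    no-path-longer-than : ∀ k {h q rest} → IsPathIn T R (h ∷ q ∷ rest) → ∣ R ∣ ≤ k + length rest → ⊥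
    no-path-longer-than zero    (unique , _ , ⊆R) ∣R∣≤ =
      <⇒≱ (≤-trans (s≤s ∣R∣≤) (n≤1+n _)) (unique⇒length≤∣∣ unique ⊆R)
    no-path-longer-than (suc k) {rest = rest} path ∣R∣≤ =
      no-pendant (unextendable⇒pendant path λ x longer →
        no-path-longer-than k longer (≤-trans ∣R∣≤ (≤-reflexive (sym (+-suc k (length rest))))))

  pendant-exists : ConnectedIn T R → ∀ {t t′} → t ∈ˢ R → t′ ∈ˢ R → t ≢ t′ → ¬ ¬ ∃₂ (Pendant T R)
  pendant-exists connected t∈R t′∈R t≢t′ no-pendant = first-edge (connected t∈R t′∈R) t≢t′
    where
      first-edge : ∀ {u v} → WalkIn T (_∈ˢ R) u v → u ≢ v → ⊥
      first-edge (stop _)          u≢u = u≢u refl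
      first-edge (step u∈R uw wv) _   =
        no-path-longer-than (λ pendant → no-pendant (_ , _ , pendant)) ∣ R ∣
          ((adj⇒≢ T uw ∷ []) ∷ [] ∷ [] , symm T uw ∷ [-] , walk-head wv ∷ u∈R ∷ [])
          (m≤m+n ∣ R ∣ 0)

-- A biclique meets some bag in a whole side

pairwise⇒one-side : ∀ {a b} {P : Fin a → Set} {Q : Fin b → Set} → (∀ i j → P i × Q j) → (∀ i → P i) ⊎ (∀ j → Q j)
pairwise⇒one-side {b = zero}  _  = inj₂ λ ()
pairwise⇒one-side {b = suc _} PQ = inj₁ λ i → proj₁ (PQ i zero)

module _ {G : Graph m} (D : TreeDecomposition G) {a b} (A : Fin a → Fin m) (B : Fin b → Fin m) where
  private
    T    = tree D
    Node = Fin (suc (nodes D))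

  ContainsSide : Node → Set
  ContainsSide t = (∀ i → A i ∈ˢ bag D t) ⊎ (∀ j → B j ∈ˢ bag D t)

  record CoveringSubtree (R : Subset (suc (nodes D))) : Set where
    field
      nonempty   : ∃ (_∈ˢ R)
      connected  : ConnectedIn T R
      vertConnIn : ∀ v {t t′} → t ∈ˢ R → t′ ∈ˢ R → v ∈ˢ bag D t → v ∈ˢ bag D t′ →
                   WalkIn T (λ s → s ∈ˢ R × v ∈ˢ bag D s) t t′
      covers     : ∀ i j → ∃ λ t → t ∈ˢ R × A i ∈ˢ bag D t × B j ∈ˢ bag D t

  whole-tree : (∀ i j → Adj G (A i) (B j)) → CoveringSubtree ⊤
  whole-tree AB = record
    { nonempty   = zero , ∈⊤
    ; connected  = λ {t} {t′} _ _ → walk-map (λ _ → ∈⊤) (proj₁ (isTree D) t t′)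
    ; vertConnIn = λ v {t} {t′} _ _ vt vt′ → walk-map (∈⊤ ,_) (vertConn D v t t′ vt vt′)
    ; covers     = λ i j → let (t , ai , bj) = edgeCov D (A i) (B j) (AB i j) in t , ∈⊤ , ai , bj
    }

  module _ (no-side-bag : ∀ t → ¬ ContainsSide t) where

    module Prune {R} (C : CoveringSubtree R) {ℓ p} (pendant : Pendant T R ℓ p) where
      open CoveringSubtree C
      open Pendant pendant

      p≢ℓ : p ≢ ℓ
      p≢ℓ = adj⇒≢ T ℓ-p

      -- The bags containing v form a subtree through ℓ avoiding p, so within R they are just ℓ.
      stranded : ∀ {v t} → v ∈ˢ bag D ℓ → v ∉ˢ bag D p → t ∈ˢ R → v ∈ˢ bag D t → t ≡ ℓ
      stranded vℓ v∉p t∈R vt =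
        walk-from-pendant (only-neighbour ∘ proj₁) (v∉p ∘ proj₂) (vertConnIn _ ℓ∈R t∈R vℓ vt)

      A-kept : ∀ {i} → A i ∈ˢ bag D ℓ → A i ∈ˢ bag D p
      A-kept {i} aℓ with A i ∈? bag D p
      ... | yes ap  = ap
      ... | no  a∉p = ⊥-elim (no-side-bag ℓ (inj₂ λ j →
            let (t , t∈R , ai , bj) = covers i j in subst (λ s → B j ∈ˢ bag D s) (stranded aℓ a∉p t∈R ai) bj))

      B-kept : ∀ {j} → B j ∈ˢ bag D ℓ → B j ∈ˢ bag D p
      B-kept {j} bℓ with B j ∈? bag D p
      ... | yes bp  = bp
      ... | no  b∉p = ⊥-elim (no-side-bag ℓ (inj₁ λ i →
            let (t , t∈R , ai , bj) = covers i j in subst (λ s → A i ∈ˢ bag D s) (stranded bℓ b∉p t∈R bj) ai))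

      pruned : CoveringSubtree (R - ℓ)
      pruned = record
        { nonempty   = p , x∈p∧x≢y⇒x∈p-y p∈R p≢ℓ
        ; connected  = λ t∈R′ t′∈R′ → walk-map (λ (s∈R , s≢ℓ) → x∈p∧x≢y⇒x∈p-y s∈R s≢ℓ)
            (walk-avoiding-pendant only-neighbour p≢ℓ (x∈p-y⇒x≢y t∈R′) (x∈p-y⇒x≢y t′∈R′)
              (connected (⊆R t∈R′) (⊆R t′∈R′)))
        ; vertConnIn = λ v t∈R′ t′∈R′ vt vt′ → walk-map (λ ((s∈R , vs) , s≢ℓ) → x∈p∧x≢y⇒x∈p-y s∈R s≢ℓ , vs)
            (walk-avoiding-pendant (only-neighbour ∘ proj₁) p≢ℓ (x∈p-y⇒x≢y t∈R′) (x∈p-y⇒x≢y t′∈R′)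
              (vertConnIn v (⊆R t∈R′) (⊆R t′∈R′) vt vt′))
        ; covers     = covers′
        }
        where
          ⊆R = p─q⊆p R ⁅ ℓ ⁆
          covers′ : ∀ i j → ∃ λ t → t ∈ˢ R - ℓ × A i ∈ˢ bag D t × B j ∈ˢ bag D t
          covers′ i j with covers i j
          ... | t , t∈R , ai , bj with t ≟ᶠ ℓ
          ...   | yes refl = p , x∈p∧x≢y⇒x∈p-y p∈R p≢ℓ , A-kept ai , B-kept bj
          ...   | no  t≢ℓ = t , x∈p∧x≢y⇒x∈p-y t∈R t≢ℓ , ai , bj

    no-side-bag⇒⊥ : ∀ k {R} → ∣ R ∣ ≤ k → CoveringSubtree R → ⊥
    no-side-bag⇒⊥ zero ∣R∣≤0 C =
      let (t , t∈R) = CoveringSubtree.nonempty C in <⇒≱ (unique⇒length≤∣∣ ([] ∷ []) (t∈R ∷ [])) ∣R∣≤0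
    no-side-bag⇒⊥ (suc k) {R} ∣R∣≤ C = no-side-bag t₀ (pairwise⇒one-side λ i j →
      let (t , t∈R , ai , bj) = covers i j ; t≡t₀ = decidable-stable (t ≟ᶠ t₀) (shrink t∈R) in
      subst (λ s → A i ∈ˢ bag D s) t≡t₀ ai , subst (λ s → B j ∈ˢ bag D s) t≡t₀ bj)
      where
        open CoveringSubtree C
        t₀ = proj₁ nonempty
        -- A second node yields a pendant node, and pruning it leaves a smaller covering subtree.
        shrink : ∀ {t} → t ∈ˢ R → t ≢ t₀ → ⊥
        shrink t∈R t≢t₀ = pendant-exists (proj₂ (isTree D)) connected t∈R (proj₂ nonempty) t≢t₀
          λ (ℓ , p , pendant) → no-side-bag⇒⊥ k (≤-pred (≤-trans (x∈p⇒∣p-x∣<∣p∣ (Pendant.ℓ∈R pendant)) ∣R∣≤))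
                                   (Prune.pruned C pendant)

  biclique-in-one-bag : (∀ i j → Adj G (A i) (B j)) → ∃ ContainsSide
  biclique-in-one-bag AB with any? (λ t → all? (λ i → A i ∈? bag D t) ⊎-dec all? (λ j → B j ∈? bag D t))
  ... | yes found = found
  ... | no  none  = ⊥-elim (no-side-bag⇒⊥ (λ t c → none (t , c)) _ (∣p∣≤n (⊤ {suc (nodes D)})) (whole-tree AB))

-- Matched bags

length-endpoints : ∀ (M : List (Fin m × Fin m)) → length (endpoints M) ≡ length M + length M
length-endpoints []      = refl
length-endpoints (_ ∷ M) = cong suc (trans (cong suc (length-endpoints M)) (sym (+-suc (length M) (length M))))

endpoints⊆ : ∀ {G : Graph m} {S} M → IsMatchingIn G S M → All (_∈ˢ S) (endpoints M)
endpoints⊆ []            _                                      = []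
endpoints⊆ {G = G} ((u , w) ∷ M) ((_ , u∈S , w∈S) ∷ es , _ ∷ _ ∷ M!) = u∈S ∷ w∈S ∷ endpoints⊆ {G = G} M (es , M!)

-- Both kinds of matched bag: `exposed` is empty, or the single unmatched vertex.
record NearPerfectMatching (G : Graph m) (S : Subset m) : Set where
  field
    edges      : List (Fin m × Fin m)
    isMatching : IsMatchingIn G S edges
    exposed    : List (Fin m)
    exposed≤1  : length exposed ≤ 1
    exposed⊆S  : All (_∈ˢ S) exposed
    disjoint   : Unique (exposed ++ endpoints edges)
    spans      : ∀ v → v ∈ˢ S → v ∈ₗ exposed ++ endpoints edges

  size : length exposed + (length edges + length edges) ≤ ∣ S ∣
  size = begin
    length exposed + (length edges + length edges)  ≡⟨ cong (length exposed +_) (length-endpoints edges) ⟨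
    length exposed + length (endpoints edges)       ≡⟨ length-++ exposed ⟨
    length (exposed ++ endpoints edges)             ≤⟨ unique⇒length≤∣∣ disjoint (All.++⁺ exposed⊆S (endpoints⊆ {G = G} edges isMatching)) ⟩
    ∣ S ∣                                           ∎
    where open ≤-Reasoning

matched⇒nearPerfect : ∀ {G : Graph m} {S} → Matched G S → NearPerfectMatching G S
matched⇒nearPerfect (inj₁ (M , isM , covered)) =
  record { edges = M ; isMatching = isM ; exposed = [] ; exposed≤1 = z≤n ; exposed⊆S = []
         ; disjoint = proj₂ isM ; spans = covered }
matched⇒nearPerfect {S = S} (inj₂ (M , isM , v , v∈S , v∉M , covered , _)) =
  record { edges = M ; isMatching = isM ; exposed = v ∷ [] ; exposed≤1 = s≤s z≤n ; exposed⊆S = v∈S ∷ []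
         ; disjoint = ¬Any⇒All¬ _ v∉M ∷ proj₂ isM ; spans = spans }
  where
    spans : ∀ w → w ∈ˢ S → w ∈ₗ v ∷ endpoints M
    spans w w∈S with w ≟ᶠ v
    ... | yes w≡v = here w≡v
    ... | no  w≢v = there (covered w w∈S w≢v)

module _ {G : Graph m} (colour : Fin m → Bool) (proper : ∀ {u w} → Adj G u w → colour u ≢ colour w) where

  endOfColour : Bool → Fin m × Fin m → Fin m
  endOfColour c (u , w) with colour u Bool.≟ c
  ... | yes _ = u
  ... | no  _ = w

  ∈-endpoints⇒∈-endsOfColour : ∀ {S} c M → IsMatchingIn G S M → ∀ {x} → x ∈ₗ endpoints M → colour x ≡ c →
                                x ∈ₗ map (endOfColour c) M
  ∈-endpoints⇒∈-endsOfColour c ((u , w) ∷ M) _ (here refl) cu with colour u Bool.≟ c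
  ... | yes _  = here refl
  ... | no  ¬c = ⊥-elim (¬c cu)
  ∈-endpoints⇒∈-endsOfColour c ((u , w) ∷ M) ((uw , _) ∷ _ , _) (there (here refl)) cw with colour u Bool.≟ c
  ... | yes cu = ⊥-elim (proper uw (trans cu (sym cw)))
  ... | no  _  = here refl
  ∈-endpoints⇒∈-endsOfColour c (_ ∷ M) (_ ∷ es , _ ∷ _ ∷ M!) (there (there x∈M)) cx =
    there (∈-endpoints⇒∈-endsOfColour c M (es , M!) x∈M cx)

  -- Each edge has one end of each colour, so a colour class meets the matching in at most |M| vertices.
  colourClass≤ : ∀ {S} (near : NearPerfectMatching G S) → let open NearPerfectMatching near in
                 ∀ {k} c (f : Fin k → Fin m) → (∀ {i j} → f i ≡ f j → i ≡ j) →
                 (∀ i → colour (f i) ≡ c) → (∀ i → f i ∈ˢ S) → k ≤ length exposed + length edges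
  colourClass≤ near c f f-inj f-c f∈S =
    subst (_ ≤_) (trans (length-++ exposed) (cong (length exposed +_) (length-map (endOfColour c) edges)))
      (injective⇒≤length f f-inj f∈)
    where
      open NearPerfectMatching near
      f∈ : ∀ i → f i ∈ₗ exposed ++ map (endOfColour c) edges
      f∈ i with ∈-++⁻ exposed (spans (f i) (f∈S i))
      ... | inj₁ ∈exposed = ∈-++⁺ˡ ∈exposed
      ... | inj₂ ∈edges   = ∈-++⁺ʳ exposed (∈-endpoints⇒∈-endsOfColour c edges isMatching ∈edges (f-c i))

  matched-colourClass≤ : ∀ {S k} → Matched G S → ∀ c (f : Fin k → Fin m) → (∀ {i j} → f i ≡ f j → i ≡ j) →
                         (∀ i → colour (f i) ≡ c) → (∀ i → f i ∈ˢ S) → k + k ≤ suc ∣ S ∣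
  matched-colourClass≤ {S} {k} matched c f f-inj f-c f∈S = begin
    k + k                 ≤⟨ +-mono-≤ k≤ k≤ ⟩
    (e + M) + (e + M)     ≡⟨ rearrange e M ⟩
    e + (e + (M + M))     ≤⟨ +-monoˡ-≤ (e + (M + M)) exposed≤1 ⟩
    1 + (e + (M + M))     ≤⟨ s≤s size ⟩
    suc ∣ S ∣             ∎
    where
      open ≤-Reasoning
      near = matched⇒nearPerfect matched
      open NearPerfectMatching near
      e = length exposed
      M = length edges
      k≤ = colourClass≤ near c f f-inj f-c f∈S
      rearrange : ∀ e M → (e + M) + (e + M) ≡ e + (e + (M + M))
      rearrange = +-*-Solver.solve 2 (λ e M → (e :+ M) :+ (e :+ M) := e :+ (e :+ (M :+ M))) refl
        where open +-*-Solver

-- Width bounds for K_{n,n}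

≤-maxOver : ∀ {k} (f : Fin k → ℕ) i → f i ≤ maxOver f
≤-maxOver f zero    = m≤m⊔n _ _
≤-maxOver f (suc i) = ≤-trans (≤-maxOver (f ∘ suc) i) (m≤n⊔m _ _)

bag-size≤width : ∀ {G : Graph m} (D : TreeDecomposition G) t → ∣ bag D t ∣ ∸ 1 ≤ width D
bag-size≤width D t = ∸-monoˡ-≤ 1 (≤-maxOver (λ t → ∣ bag D t ∣) t)

-- A cycle has at least three distinct vertices.
acyclic-on-two-vertices : ∀ (G : Graph 2) → Acyclic G
acyclic-on-two-vertices G x xs (2≤length , unique , _) =
  <⇒≱ (s≤s 2≤length) (unique⇒length≤∣∣ unique (All.universal (λ _ → ∈⊤) (x ∷ xs)))

K₂ : Graph 2
K₂ = record { Adj = _≢_ ; symm = ≢-sym ; irrefl = λ u≢u → u≢u refl }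

K₂-isTree : IsTree K₂
K₂-isTree = connected , acyclic-on-two-vertices K₂
  where
    connected : Connected K₂
    connected u v with u ≟ᶠ v
    ... | yes refl = stop _
    ... | no  u≢v  = step _ u≢v (stop _)

∈∁⁅⁆ : ∀ {u v : Fin m} → u ≢ v → u ∈ˢ ∁ ⁅ v ⁆
∈∁⁅⁆ = x∉p⇒x∈∁p ∘ x≢y⇒x∉⁅y⁆

∣∁⁅x⁆∣ : ∀ (x : Fin m) → ∣ ∁ ⁅ x ⁆ ∣ ≡ m ∸ 1
∣∁⁅x⁆∣ {m} x = trans (∣∁p∣≡n∸∣p∣ ⁅ x ⁆) (cong (m ∸_) (∣⁅x⁆∣≡1 x))

module _ {G : Graph m} {x y : Fin m} (x≢y : x ≢ y) (x≁y : ¬ Adj G x y) where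

  omitting : Fin 2 → Subset m
  omitting zero       = ∁ ⁅ x ⁆
  omitting (suc zero) = ∁ ⁅ y ⁆

  -- No edge joins x and y, so every edge lies in one of the bags V ∖ {x}, V ∖ {y}.
  twoBagDecomposition : TreeDecomposition G
  twoBagDecomposition = record
    { nodes = 1 ; tree = K₂ ; isTree = K₂-isTree ; bag = omitting
    ; edgeCov = edgeCov′ ; vertNonempty = vertNonempty′ ; vertConn = vertConn′ }
    where
      edgeCov′ : ∀ u v → Adj G u v → ∃ λ t → u ∈ˢ omitting t × v ∈ˢ omitting t
      edgeCov′ u v uv with u ≟ᶠ x | v ≟ᶠ x
      ... | yes refl | _        = suc zero , ∈∁⁅⁆ x≢y , ∈∁⁅⁆ λ { refl → x≁y uv }
      ... | no  _    | yes refl = suc zero , ∈∁⁅⁆ (λ { refl → x≁y (symm G uv) }) , ∈∁⁅⁆ x≢y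
      ... | no  u≢x  | no  v≢x  = zero , ∈∁⁅⁆ u≢x , ∈∁⁅⁆ v≢x

      vertNonempty′ : ∀ v → ∃ λ t → v ∈ˢ omitting t
      vertNonempty′ v with v ≟ᶠ x
      ... | yes refl = suc zero , ∈∁⁅⁆ x≢y
      ... | no  v≢x  = zero , ∈∁⁅⁆ v≢x

      vertConn′ : ∀ v t t′ → v ∈ˢ omitting t → v ∈ˢ omitting t′ → WalkIn K₂ (λ s → v ∈ˢ omitting s) t t′
      vertConn′ v t t′ vt vt′ with t ≟ᶠ t′
      ... | yes refl = stop vt
      ... | no  t≢t′ = step vt t≢t′ (stop vt′)

  width-twoBagDecomposition : width twoBagDecomposition ≡ m ∸ 2
  width-twoBagDecomposition = begin
    (∣ ∁ ⁅ x ⁆ ∣ ⊔ (∣ ∁ ⁅ y ⁆ ∣ ⊔ 0)) ∸ 1 ≡⟨ cong (_∸ 1) (cong₂ _⊔_ (∣∁⁅x⁆∣ x) (trans (⊔-identityʳ _) (∣∁⁅x⁆∣ y))) ⟩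
    ((m ∸ 1) ⊔ (m ∸ 1)) ∸ 1               ≡⟨ cong (_∸ 1) (⊔-idem (m ∸ 1)) ⟩
    m ∸ 1 ∸ 1                             ≡⟨ ∸-+-assoc m 1 1 ⟩
    m ∸ 2                                 ∎
    where open ≡-Reasoning

module _ (n : ℕ) where

  left right : Fin n → Fin (n + n)
  left  i = i ↑ˡ n
  right j = n ↑ʳ j

  side-left : ∀ i → side n (left i) ≡ true
  side-left i rewrite splitAt-↑ˡ n i n = refl

  side-right : ∀ j → side n (right j) ≡ false
  side-right j rewrite splitAt-↑ʳ n n j = refl

  left-right-adjacent : ∀ i j → Adj (K n) (left i) (right j)
  left-right-adjacent i j eq with trans (sym (side-left i)) (trans eq (side-right j))
  ... | ()

  left-left-nonadjacent : ∀ i i′ → ¬ Adj (K n) (left i) (left i′)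
  left-left-nonadjacent i i′ ne = ne (trans (side-left i) (sym (side-left i′)))

  left≢right : ∀ i j → left i ≢ right j
  left≢right i j = left-right-adjacent i j ∘ cong (side n)

  left-injective : ∀ {i i′} → left i ≡ left i′ → i ≡ i′
  left-injective = ↑ˡ-injective n _ _

  right-injective : ∀ {j j′} → right j ≡ right j′ → j ≡ j′
  right-injective = ↑ʳ-injective n _ _

  left-or-right : ∀ w → (∃ λ i → w ≡ left i) ⊎ (∃ λ j → w ≡ right j)
  left-or-right w with splitAt n w in eq
  ... | inj₁ i = inj₁ (i , sym (splitAt⁻¹-↑ˡ eq))
  ... | inj₂ j = inj₂ (j , sym (splitAt⁻¹-↑ʳ eq))

  diagonal : List (Fin n) → List (Fin (n + n) × Fin (n + n))
  diagonal = map λ i → left i , right i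

  ∈-endpoints-diagonal⁻ : ∀ L {x} → x ∈ₗ endpoints (diagonal L) → ∃ λ i → i ∈ₗ L × (x ≡ left i ⊎ x ≡ right i)
  ∈-endpoints-diagonal⁻ (i ∷ L) (here x≡)          = i , here refl , inj₁ x≡
  ∈-endpoints-diagonal⁻ (i ∷ L) (there (here x≡))  = i , here refl , inj₂ x≡
  ∈-endpoints-diagonal⁻ (i ∷ L) (there (there x∈)) =
    let (i′ , i′∈L , x≡) = ∈-endpoints-diagonal⁻ L x∈ in i′ , there i′∈L , x≡

  left∈endpoints-diagonal : ∀ L {i} → i ∈ₗ L → left i ∈ₗ endpoints (diagonal L)
  left∈endpoints-diagonal (_ ∷ L) (here refl) = here refl
  left∈endpoints-diagonal (_ ∷ L) (there i∈L) = there (there (left∈endpoints-diagonal L i∈L))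

  right∈endpoints-diagonal : ∀ L {i} → i ∈ₗ L → right i ∈ₗ endpoints (diagonal L)
  right∈endpoints-diagonal (_ ∷ L) (here refl) = there (here refl)
  right∈endpoints-diagonal (_ ∷ L) (there i∈L) = there (there (right∈endpoints-diagonal L i∈L))

  unique-endpoints-diagonal : ∀ {L} → Unique L → Unique (endpoints (diagonal L))
  unique-endpoints-diagonal {[]}    []          = []
  unique-endpoints-diagonal {i ∷ L} (i∉L ∷ L!) =
    (left≢right i i ∷ All.tabulate (left-fresh ∘ ∈-endpoints-diagonal⁻ L))
    ∷ All.tabulate (right-fresh ∘ ∈-endpoints-diagonal⁻ L)
    ∷ unique-endpoints-diagonal L!
    where
      left-fresh : ∀ {x} → (∃ λ i′ → i′ ∈ₗ L × (x ≡ left i′ ⊎ x ≡ right i′)) → left i ≢ x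
      left-fresh (i′ , i′∈L , inj₁ refl) eq = All.lookup i∉L i′∈L (left-injective eq)
      left-fresh (i′ , i′∈L , inj₂ refl) eq = left≢right i i′ eq
      right-fresh : ∀ {x} → (∃ λ i′ → i′ ∈ₗ L × (x ≡ left i′ ⊎ x ≡ right i′)) → right i ≢ x
      right-fresh (i′ , i′∈L , inj₁ refl) eq = left≢right i′ i (sym eq)
      right-fresh (i′ , i′∈L , inj₂ refl) eq = All.lookup i∉L i′∈L (right-injective eq)

  -- Match left i with right i for i ≠ j; right j stays exposed, next to the matched left j′.
  omit-left-matched : ∀ {j j′} → j′ ≢ j → Matched (K n) (∁ ⁅ left j ⁆)
  omit-left-matched {j} {j′} j′≢j =
    inj₂ (diagonal L , (edges-in , unique-endpoints-diagonal L!) , right j , ∈∁⁅⁆ (≢-sym (left≢right j j)) ,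
          right-j-exposed , covered , left j′ , left∈endpoints-diagonal L (∈L j′≢j) ,
          symm (K n) (left-right-adjacent j′ j))
    where
      ≢j? = λ i → ¬? (i ≟ᶠ j)
      L   = filter ≢j? (allFin n)
      L!  : Unique L
      L!  = filter⁺ ≢j? (allFin⁺ n)
      ∈L  : ∀ {i} → i ≢ j → i ∈ₗ L
      ∈L  = ∈-filter⁺ ≢j? (∈-allFin _)
      ∈L⁻ : ∀ {i} → i ∈ₗ L → i ≢ j
      ∈L⁻ = proj₂ ∘ ∈-filter⁻ ≢j? {xs = allFin n}
      ∉∁⁅left-j⁆ : ∀ {w} → w ∈ˢ ∁ ⁅ left j ⁆ → w ≢ left j
      ∉∁⁅left-j⁆ w∈ refl = x∈∁p⇒x∉p w∈ (x∈⁅x⁆ _)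
      edges-in : All (λ { (u , w) → Adj (K n) u w × u ∈ˢ ∁ ⁅ left j ⁆ × w ∈ˢ ∁ ⁅ left j ⁆ }) (diagonal L)
      edges-in = All.map⁺ (All.tabulate λ {i} i∈L →
        left-right-adjacent i i , ∈∁⁅⁆ (∈L⁻ i∈L ∘ left-injective) , ∈∁⁅⁆ (≢-sym (left≢right j i)))
      right-j-exposed : ¬ right j ∈ₗ endpoints (diagonal L)
      right-j-exposed rj∈ with ∈-endpoints-diagonal⁻ L rj∈
      ... | i , _    , inj₁ eq = left≢right i j (sym eq)
      ... | i , i∈L , inj₂ eq = ∈L⁻ i∈L (sym (right-injective eq))
      covered : ∀ w → w ∈ˢ ∁ ⁅ left j ⁆ → w ≢ right j → w ∈ₗ endpoints (diagonal L)
      covered w w∈ w≢ with left-or-right w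
      ... | inj₁ (i , refl) = left∈endpoints-diagonal L (∈L (∉∁⁅left-j⁆ w∈ ∘ cong left))
      ... | inj₂ (i , refl) = right∈endpoints-diagonal L (∈L (w≢ ∘ cong right))

K-width-lower : ∀ n (D : TreeDecomposition (K n)) → AllBagsMatched D → 2 * n ∸ 2 ≤ width D
K-width-lower n D matched = begin
  2 * n ∸ 2            ≡⟨ cong (λ z → n + z ∸ 2) (+-identityʳ n) ⟩
  n + n ∸ 2            ≤⟨ ∸-monoˡ-≤ 2 (proj₂ large-bag) ⟩
  ∣ bag D t ∣ ∸ 1      ≤⟨ bag-size≤width D t ⟩
  width D              ∎
  where
    open ≤-Reasoning
    large-bag : ∃ λ t → n + n ≤ suc ∣ bag D t ∣
    large-bag with biclique-in-one-bag D (left n) (right n) (left-right-adjacent n)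
    ... | t , inj₁ lefts  =
      t , matched-colourClass≤ {G = K n} (side n) id (matched t) true (left n) (left-injective n) (side-left n) lefts
    ... | t , inj₂ rights =
      t , matched-colourClass≤ {G = K n} (side n) id (matched t) false (right n) (right-injective n) (side-right n) rights
    t = proj₁ large-bag

K-width-upper : ∀ k → let n = suc (suc k) in
                Σ (TreeDecomposition (K n)) λ D → AllBagsMatched D × width D ≡ 2 * n ∸ 2
K-width-upper k = D , matched , width≡
  where
    n = suc (suc k)
    0≢1 : left n zero ≢ left n (suc zero)
    0≢1 eq with left-injective n {zero} {suc zero} eq
    ... | ()
    0≁1 = left-left-nonadjacent n zero (suc zero)
    D = twoBagDecomposition {G = K n} 0≢1 0≁1
    matched : AllBagsMatched D
    matched zero       = omit-left-matched n {zero} {suc zero} λ ()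
    matched (suc zero) = omit-left-matched n {suc zero} {zero} λ ()
    width≡ : width D ≡ 2 * n ∸ 2
    width≡ = trans (width-twoBagDecomposition {G = K n} 0≢1 0≁1) (cong (λ z → n + z ∸ 2) (sym (+-identityʳ n)))

proposition1 : ∀ (n : ℕ) → 1 < n → MtwIs (K n) (2 * n ∸ 2)
proposition1 (suc (suc k)) (s≤s (s≤s _)) = K-width-upper k , K-width-lower (suc (suc k))
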